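{- Let $\vdash A$ be a closed type which is discrete, i.e. $\forall_{f:\mathbb I\to A}\forall_{i:\mathbb I}\,fi=f0$ holds. Then $A$ has a fibration structure, i.e. there is a global element of $\mathrm{Fib}(A)$.
   Context: Let $\mathcal E$ be a model of extensional dependent type theory (category with families) with dependent products, dependent sums, extensional identity types, unit type, disjoint finite coproducts and propositional truncation; we use its internal language. A type is a proposition if any two elements are equal; $\forall,\wedge,\lor$ are $\prod$, $\times$, truncated $+$ on propositions; $\{x:A\mid\varphi\}:=\sum_{x:A}\varphi$; $\mathbf 2:=\mathbf 1+\mathbf 1$ with elements $0,1$ and $\bar0=1,\bar1=0$. $\mathcal E$ is equipped with a closed type $\mathbb I$ with elements $0,1$ and binary operations $\sqcap,\sqcup$, a propositional universe $\mathrm{Cof}$ (a type with a family $\mathrm{el}$ of propositions over it; we identify $\varphi:\mathrm{Cof}$ with $\mathrm{el}(\varphi)$), and satisfies (among others) $\neg(0=1)$. $\mathbf 2$ is regarded as a subtype of $\mathbb I$ via the end-points. For a type $\Gamma,i:\mathbb I\vdash A(i)$, $\mathrm{Comp}^i(A(i)):=\prod_{e:\mathbf 2}\prod_{\varphi:\mathrm{Cof}}\prod_{f:\varphi\to\prod_{i:\mathbb I}A(i)}\prod_{a:A(e)}(\forall_{u:\varphi}fue=a)\to\{a':A(\bar e)\mid\forall_{u:\varphi}fu\bar e=a'\}$. For a type $\gamma:\Gamma\vdash A(\gamma)$, $\mathrm{Fib}(A):=\prod_{p:\mathbb I\to\Gamma}\mathrm{Comp}^i(A(pi))$, a closed type;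 for a closed type $A$ (empty context $\Gamma$), this is $\prod_{p:\mathbb I\to\mathbf 1}\mathrm{Comp}^i(A)$. -}

module Defs where

open import Data.Bool using (Bool; true; false; not)
open import Data.Product using (Σ)
open import Data.Empty using (⊥)
open import Relation.Binary.PropositionalEquality using (_≡_)
open import Relation.Nullary using (¬_)

-- We use Agda itself as the internal language of the model E.
record IntervalModel : Set₁ where
  field
    𝕀    : Set
    i0   : 𝕀
    i1   : 𝕀
    _⊓_  : 𝕀 → 𝕀 → 𝕀
    _⊔_  : 𝕀 → 𝕀 → 𝕀
    Cof  : Set
    el   : Cof → Set
    el-isProp : (φ : Cof) (u v : el φ) → u ≡ v
    0≠1  : ¬ (i0 ≡ i1)

module _ (M : IntervalModel) where
  open IntervalModel M

  -- 𝟐 = Bool regarded as a subtype of 𝕀 via the endpoints (false ↦ 0, true ↦ 1);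
  -- ē is `not e`.
  ⌜_⌝ : Bool → 𝕀
  ⌜ false ⌝ = i0
  ⌜ true ⌝  = i1

  Comp : (𝕀 → Set) → Set
  Comp A = (e : Bool) (φ : Cof) (f : el φ → (i : 𝕀) → A i) (a : A ⌜ e ⌝)
         → ((u : el φ) → f u ⌜ e ⌝ ≡ a)
         → Σ (A ⌜ not e ⌝) (λ a' → (u : el φ) → f u ⌜ not e ⌝ ≡ a')

  Fib : (Γ : Set) → (Γ → Set) → Set
  Fib Γ A = (p : 𝕀 → Γ) → Comp (λ i → A (p i))

  Discrete : Set → Set
  Discrete A = (f : 𝕀 → A) (i : 𝕀) → f i ≡ f i0

module Submission where

-- Idea: in a discrete type every path f : 𝕀 → A is constant, so any two of
-- its values agree; in particular f e = f ē.  Hence, to compose a partial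
-- path f (defined on φ) with a base point a : A agreeing with f at e, we may
-- simply return a itself: for u : φ we have f u ē = f u e = a.

open import Defs
open import Data.Bool using (not)
open import Data.Unit using (⊤)
open import Data.Product using (_,_)
open import Relation.Binary.PropositionalEquality using (_≡_; sym; trans)

module _ (M : IntervalModel) where
  open IntervalModel M

  discrete-paths-constant : {A : Set} → Discrete M A →
                            (f : 𝕀 → A) (i j : 𝕀) → f i ≡ f j
  discrete-paths-constant discrete f i j =
    trans (discrete f i) (sym (discrete f j))

  discrete-comp : {A : Set} → Discrete M A → Comp M (λ _ → A)
  discrete-comp discrete e φ f a agrees =
    a , λ u → trans (discrete-paths-constant discrete (f u) (⌜ M ⌝ (not e)) (⌜ M ⌝ e))
                    (agrees u)

proposition3p6 : (M : IntervalModel) (A : Set) → Discrete M A → Fib M ⊤ (λ _ → A)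
proposition3p6 M A discrete _ = discrete-comp M discrete
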